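{- Let $t\ge 2$ and let $G$ be a $t$-connected chordal graph. (a) $\text{min-seed}(G,t)=t$, where $(G,t)$ denotes $G$ with constant threshold $t$ at every vertex. (b) If $\theta$ is a threshold function on $G$ with $\theta(x)\le t$ for every vertex $x$ and $\theta(v)<t$ for some vertex $v$, then $\text{min-seed}(G,\theta)<t$.
   Context: A graph is chordal if it has no induced cycle of length greater than three. For a finite simple graph $G$ with threshold function $\theta:V(G)\to\mathbb{Z}$ and a target set $S\subseteq V(G)$, the activation process is: at time $0$ the vertices of $S$ are active and all others inactive; at each subsequent time step, every inactive vertex $u$ having at least $\theta(u)$ active neighbours becomes active. The process stops when no more vertices become active; $[S]^G_\theta$ denotes the set of active vertices at the end. $\text{min-seed}(G,\theta)=\min\{|S|: S\subseteq V(G),\ [S]^G_\theta=V(G)\}$. -}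

module Defs where

open import Data.Nat using (ℕ; zero; suc; _<_; _≤_)
open import Data.Bool using (Bool; true; false; _∨_)
open import Data.Integer as ℤ using (ℤ; +_)
open import Data.Fin using (Fin; toℕ)
open import Data.Fin.Subset using (Subset; _∩_; ∣_∣; ⊤; _∉_)
open import Data.Vec using (tabulate; lookup)
open import Data.Product using (_×_; Σ; _,_)
open import Data.Sum using (_⊎_)
open import Relation.Binary.PropositionalEquality using (_≡_)
open import Relation.Nullary using (¬_)
open import Relation.Nullary.Decidable using (⌊_⌋)
open import Function using (_⇔_)
open import Function.Definitions using (Injective)

record Graph : Set where
  field
    n       : ℕ
    adj     : Fin n → Fin n → Bool
    adj-sym : ∀ u v → adj u v ≡ adj v u
    irrefl  : ∀ u → adj u u ≡ false
open Graph public

CycAdj : (k : ℕ) → Fin k → Fin k → Set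
CycAdj k i j =
  (suc (toℕ i) ≡ toℕ j) ⊎ (suc (toℕ j) ≡ toℕ i)
  ⊎ (toℕ i ≡ 0 × suc (toℕ j) ≡ k) ⊎ (toℕ j ≡ 0 × suc (toℕ i) ≡ k)

InducedCycle : (G : Graph) → (k : ℕ) → (Fin k → Fin (n G)) → Set
InducedCycle G k c =
  Injective _≡_ _≡_ c × (∀ i j → (adj G (c i) (c j) ≡ true) ⇔ CycAdj k i j)

Chordal : Graph → Set
Chordal G = ∀ k → 4 ≤ k → (c : Fin k → Fin (n G)) → ¬ InducedCycle G k c

data PathAvoiding (G : Graph) (X : Subset (n G)) : Fin (n G) → Fin (n G) → Set where
  here : ∀ {u} → u ∉ X → PathAvoiding G X u u
  step : ∀ {u w v} → u ∉ X → adj G u w ≡ true → PathAvoiding G X w v → PathAvoiding G X u v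

ConnectedAvoiding : (G : Graph) → Subset (n G) → Set
ConnectedAvoiding G X = ∀ u v → u ∉ X → v ∉ X → PathAvoiding G X u v

Connectedness : ℕ → Graph → Set
Connectedness t G = t < n G × (∀ (X : Subset (n G)) → ∣ X ∣ < t → ConnectedAvoiding G X)

Threshold : Graph → Set
Threshold G = Fin (n G) → ℤ

N : (G : Graph) → Fin (n G) → Subset (n G)
N G u = tabulate (adj G u)

activationStep : (G : Graph) → Threshold G → Subset (n G) → Subset (n G)
activationStep G θ A =
  tabulate (λ u → lookup A u ∨ ⌊ θ u ℤ.≤? + ∣ N G u ∩ A ∣ ⌋)

iter : ∀ {A : Set} → ℕ → (A → A) → A → A
iter zero    f x = x
iter (suc k) f x = f (iter k f x)

-- [S]^G_θ : the process stabilises after at most |V(G)| steps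
-- (each non-final step activates a new vertex).
closure : (G : Graph) → Threshold G → Subset (n G) → Subset (n G)
closure G θ S = iter (n G) (activationStep G θ) S

Seeds : (G : Graph) → Threshold G → Subset (n G) → Set
Seeds G θ S = closure G θ S ≡ ⊤

MinSeedIs : (G : Graph) → Threshold G → ℕ → Set
MinSeedIs G θ m =
  Σ (Subset (n G)) (λ S → Seeds G θ S × ∣ S ∣ ≡ m)
  × (∀ S → Seeds G θ S → m ≤ ∣ S ∣)

MinSeedBelow : (G : Graph) → Threshold G → ℕ → Set
MinSeedBelow G θ m = Σ (Subset (n G)) (λ S → Seeds G θ S × ∣ S ∣ < m)

const-θ : (G : Graph) → ℕ → Threshold G
const-θ G t = λ _ → + t

module Submission where

-- Lower bound in (a): under the constant threshold t, fewer than t active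
-- vertices never activate anybody, so every seed set has at least t vertices.
--
-- Call A ⊆ V(G) clique-attached when any two distinct vertices
-- of A that have neighbours in a common component of G − A are adjacent.
-- Extension step: if A is clique-attached and A ≠ V(G), an outside vertex h
-- with the largest number of neighbours in A is adjacent to every vertex of A
-- attached to its component (otherwise chordality is violated, by the chord
-- lemma on induced paths), hence A ∪ {h} is again clique-attached; moreover,
-- by t-connectivity, h has ≥ t neighbours in A or is adjacent to all of A,
-- because N(h) ∩ A separates h from the rest of A.
-- Applying the step t − 1 times to a single vertex v gives a clique K ∋ v of
-- size t; applying it from a clique-attached set of size ≥ t activates the
-- whole graph one vertex at a time.  The seed set is K for (a) and K − v for
-- (b), where θ(v) < t lets v be activated by its t − 1 neighbours in K − v.

open import Defs
open import Data.Nat using (ℕ; zero; suc; _≤_; _<_; z≤n; s≤s; _+_; _∸_)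
open import Data.Nat.Properties as ℕₚ using ()
open import Data.Integer as ℤ using (+_)
open import Data.Integer.Properties as ℤₚ using (i<j⇒i≤pred[j])
open import Data.Product using (_×_; Σ; Σ-syntax; ∃; _,_; proj₁; proj₂)
open import Data.Sum using (_⊎_; inj₁; inj₂)
import Data.Sum as Sum
open import Data.Fin using (Fin; toℕ; zero; suc)
import Data.Fin.Properties as Finₚ
open import Data.Fin.Properties using () renaming (_≟_ to _≟ᶠ_)
open import Data.Bool using (true; false; _∨_)
open import Data.Bool.Properties using (∨-zeroʳ; ∨-identityʳ) renaming (_≟_ to _≟ᵇ_)
open import Data.Empty using (⊥-elim)
open import Data.Unit using (tt) renaming (⊤ to Unit)
open import Data.List as List using (List; []; _∷_; _++_; length)
open import Data.List.Properties using (length-++-≤ʳ)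
open import Data.List.Relation.Unary.All as All using (All; []; _∷_)
open import Data.List.Relation.Unary.All.Properties as Allₚ using (¬Any⇒All¬)
open import Data.List.Relation.Unary.Any as Any using (Any; here; there; any?)
open import Data.List.Membership.Propositional using () renaming (_∈_ to _∈ˡ_)
open import Data.List.Membership.Propositional.Properties using (∈-++⁺ʳ)
import Data.Fin.Subset as Sb
open import Data.Fin.Subset using (Subset; _∈_; _∉_; ∣_∣; _∩_; _∪_; ⁅_⁆; _⊆_; ⊤)
open import Data.Fin.Subset.Properties as Subsetₚ using (_∈?_)
open import Data.Vec using (lookup)
open import Data.Vec.Properties as Vecₚ using ()
open import Relation.Binary.PropositionalEquality
open import Relation.Nullary using (¬_; Dec; yes; no; _⊎-dec_; ¬?)
open import Relation.Nullary.Decidable using (⌊_⌋; decidable-stable)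
open import Function using (mk⇔)

∈∪⁅⁆⁻ : ∀ {m} {A : Subset m} {h x} → x ∈ A ∪ ⁅ h ⁆ → x ∈ A ⊎ x ≡ h
∈∪⁅⁆⁻ {A = A} {h} m = Sum.map₂ (Subsetₚ.x∈⁅y⁆⇒x≡y h) (Subsetₚ.x∈p∪q⁻ A ⁅ h ⁆ m)

∈∪⁅⁆ˡ : ∀ {m} {A : Subset m} {h x} → x ∈ A → x ∈ A ∪ ⁅ h ⁆
∈∪⁅⁆ˡ m = Subsetₚ.x∈p∪q⁺ (inj₁ m)

∈∪⁅⁆ʳ : ∀ {m} {A : Subset m} {h} → h ∈ A ∪ ⁅ h ⁆
∈∪⁅⁆ʳ {h = h} = Subsetₚ.x∈p∪q⁺ (inj₂ (Subsetₚ.x∈⁅x⁆ h))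

∣∪⁅⁆∣ : ∀ {m} (A : Subset m) (h : Fin m) → h ∉ A → ∣ A ∪ ⁅ h ⁆ ∣ ≡ suc ∣ A ∣
∣∪⁅⁆∣ (true  Data.Vec.∷ A) zero    h∉ = ⊥-elim (h∉ Data.Vec.here)
∣∪⁅⁆∣ (false Data.Vec.∷ A) zero    h∉ = cong suc (cong ∣_∣ (Subsetₚ.∪-identityʳ A))
∣∪⁅⁆∣ (true  Data.Vec.∷ A) (suc h) h∉ = cong suc (∣∪⁅⁆∣ A h (λ m → h∉ (Data.Vec.there m)))
∣∪⁅⁆∣ (false Data.Vec.∷ A) (suc h) h∉ = ∣∪⁅⁆∣ A h (λ m → h∉ (Data.Vec.there m))

outside-element : ∀ {m} (A : Subset m) → ∣ A ∣ < m → ∃ (_∉ A)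
outside-element {m} A lt with Finₚ.any? (λ x → ¬? (x ∈? A))
... | yes found = found
... | no none = ⊥-elim (ℕₚ.<⇒≱ lt (subst (_≤ ∣ A ∣) (Subsetₚ.∣⊤∣≡n m) (Subsetₚ.p⊆q⇒∣p∣≤∣q∣ all-in)))
  where
  all-in : ⊤ ⊆ A
  all-in {x} _ = decidable-stable (x ∈? A) (λ x∉ → none (x , x∉))

argmax : ∀ m (f : Fin m → ℕ) (P : Fin m → Set) → (∀ i → Dec (P i)) →
  (∀ i → ¬ P i) ⊎ Σ[ i ∈ Fin m ] (P i × (∀ j → P j → f j ≤ f i))
argmax zero f P P? = inj₁ (λ ())
argmax (suc m) f P P? with argmax m (λ i → f (suc i)) (λ i → P (suc i)) (λ i → P? (suc i)) | P? zero
... | inj₁ none | yes p0 = inj₂ (zero , p0 , λ { zero _ → ℕₚ.≤-refl ; (suc j) pj → ⊥-elim (none j pj) })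
... | inj₁ none | no ¬p0 = inj₁ (λ { zero → ¬p0 ; (suc j) → none j })
... | inj₂ (i , pi , max) | no ¬p0 = inj₂ (suc i , pi , λ { zero p → ⊥-elim (¬p0 p) ; (suc j) pj → max j pj })
... | inj₂ (i , pi , max) | yes p0 with f zero ℕₚ.≤? f (suc i)
...   | yes le = inj₂ (suc i , pi , λ { zero _ → le ; (suc j) pj → max j pj })
...   | no nle = inj₂ (zero , p0 , λ { zero _ → ℕₚ.≤-refl
                                     ; (suc j) pj → ℕₚ.≤-trans (max j pj) (ℕₚ.<⇒≤ (ℕₚ.≰⇒> nle)) })

module _ {X : Set} {P : X → Set} (P? : ∀ x → Dec (P x)) where

  split-last : (l : List X) → Any P l →
    Σ[ pre ∈ List X ] Σ[ z ∈ X ] Σ[ post ∈ List X ]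
      (l ≡ pre ++ z ∷ post × P z × All (λ y → ¬ P y) post)
  split-last (x ∷ xs) a with any? P? xs
  ... | yes a' with split-last xs a'
  ...   | pre , z , post , eq , pz , none = x ∷ pre , z , post , cong (x ∷_) eq , pz , none
  split-last (x ∷ xs) (here px) | no ¬a = [] , x , xs , refl , px , ¬Any⇒All¬ xs ¬a
  split-last (x ∷ xs) (there a) | no ¬a = ⊥-elim (¬a a)

  split-first : (l : List X) → Any P l →
    Σ[ pre ∈ List X ] Σ[ z ∈ X ] Σ[ post ∈ List X ]
      (l ≡ pre ++ z ∷ post × P z × All (λ y → ¬ P y) pre)
  split-first (x ∷ xs) a with P? x
  ... | yes px = [] , x , xs , refl , px , []
  split-first (x ∷ xs) (here px) | no ¬px = ⊥-elim (¬px px)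
  split-first (x ∷ xs) (there a) | no ¬px with split-first xs a
  ... | pre , z , post , eq , pz , none = x ∷ pre , z , post , cong (x ∷_) eq , pz , ¬px ∷ none

All-prefix : ∀ {X : Set} {P : X → Set} (pre : List X) {z : X} {post : List X} →
  All P (pre ++ z ∷ post) → All P (pre ++ z ∷ [])
All-prefix pre a = Allₚ.++⁺ (Allₚ.++⁻ˡ pre a) (All.head (Allₚ.++⁻ʳ pre a) ∷ [])

All-at : ∀ {X : Set} {P : X → Set} (l : List X) → All P l → (i : Fin (length l)) → P (List.lookup l i)
All-at (x ∷ l) (px ∷ _)  zero    = px
All-at (x ∷ l) (_  ∷ al) (suc i) = All-at l al i

module Graphs (G : Graph) where

  V : Set
  V = Fin (n G)

  _~_ : V → V → Set
  u ~ v = adj G u v ≡ true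

  ~-sym : ∀ {u v} → u ~ v → v ~ u
  ~-sym {u} {v} e = trans (adj-sym G v u) e

  ~-irrefl : ∀ {u} → ¬ (u ~ u)
  ~-irrefl {u} e with trans (sym e) (irrefl G u)
  ... | ()

  _~?_ : ∀ u v → Dec (u ~ v)
  u ~? v = adj G u v ≟ᵇ true

  nbrsIn : V → Subset (n G) → Subset (n G)
  nbrsIn h A = N G h ∩ A

  nbrsIn⁻ : ∀ {h x A} → x ∈ nbrsIn h A → h ~ x × x ∈ A
  nbrsIn⁻ {h} {x} {A} m with Subsetₚ.x∈p∩q⁻ (N G h) A m
  ... | x∈N , x∈A = trans (sym (Vecₚ.lookup∘tabulate (adj G h) x)) (Vecₚ.[]=⇒lookup x∈N) , x∈A

  nbrsIn⁺ : ∀ {h x A} → h ~ x → x ∈ A → x ∈ nbrsIn h A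
  nbrsIn⁺ {h} {x} e x∈A =
    Subsetₚ.x∈p∩q⁺ (Vecₚ.lookup⇒[]= x (N G h) (trans (Vecₚ.lookup∘tabulate (adj G h) x) e) , x∈A)

  nbrsIn-monotone : ∀ {h A B} → A ⊆ B → nbrsIn h A ⊆ nbrsIn h B
  nbrsIn-monotone {h} {A} A⊆B m with nbrsIn⁻ {h} {A = A} m
  ... | hx , x∈A = nbrsIn⁺ hx (A⊆B x∈A)

  nbrsIn-all : ∀ {h A} → (∀ {a} → a ∈ A → h ~ a) → ∣ A ∣ ≤ ∣ nbrsIn h A ∣
  nbrsIn-all all = Subsetₚ.p⊆q⇒∣p∣≤∣q∣ (λ m → nbrsIn⁺ (all m) m)

  Walk : V → List V → Set
  Walk h []      = Unit
  Walk h (w ∷ l) = h ~ w × Walk w l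

  endOf : V → List V → V
  endOf h []      = h
  endOf h (w ∷ l) = endOf w l

  InducedPath : V → List V → Set
  InducedPath h []      = Unit
  InducedPath h (w ∷ l) = h ~ w × All (λ z → ¬ (h ~ z) × ¬ (h ≡ z)) l × InducedPath w l

  Walk-suffix : ∀ h pre z post → Walk h (pre ++ z ∷ post) → Walk z post
  Walk-suffix h []        z post (_ , w) = w
  Walk-suffix h (x ∷ pre) z post (_ , w) = Walk-suffix x pre z post w

  endOf-suffix : ∀ h pre z post → endOf h (pre ++ z ∷ post) ≡ endOf z post
  endOf-suffix h []        z post = refl
  endOf-suffix h (x ∷ pre) z post = endOf-suffix x pre z post

  endOf-∈ : ∀ h w l → endOf h (w ∷ l) ∈ˡ (w ∷ l)
  endOf-∈ h w []      = here refl
  endOf-∈ h w (y ∷ l) = there (endOf-∈ w y l)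

  InducedPath-prefix : ∀ h pre z post → InducedPath h (pre ++ z ∷ post) → InducedPath h (pre ++ z ∷ [])
  InducedPath-prefix h []        z post (hz , _ , _) = hz , [] , tt
  InducedPath-prefix h (a ∷ pre) z post (ha , far , ip) =
    ha , All-prefix pre far , InducedPath-prefix a pre z post ip

  Shortcut : V → List V → Set
  Shortcut h l = Σ[ l' ∈ List V ]
    (InducedPath h l' × endOf h l' ≡ endOf h l × (∀ {y} → y ∈ˡ l' → y ∈ˡ l))

  shortcut : (f : ℕ) (h : V) (l : List V) → length l ≤ f → Walk h l → Shortcut h l
  shortcut f       h []      _   _ = [] , tt , refl , λ ()
  shortcut zero    h (w ∷ l) ()  _
  shortcut (suc f) h (w ∷ l) len walk
    with split-last (λ z → (z ≟ᶠ h) ⊎-dec (h ~? z)) (w ∷ l) (here (inj₂ (proj₁ walk)))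
  ... | pre , z , post , eq , pz , far = jump pz
    where
    post-walk : Walk z post
    post-walk = Walk-suffix h pre z post (subst (Walk h) eq walk)
    post-len : length post ≤ f
    post-len = ℕₚ.≤-pred (ℕₚ.≤-trans (length-++-≤ʳ (z ∷ post) {pre}) (subst (λ q → length q ≤ suc f) eq len))
    same-end : endOf z post ≡ endOf h (w ∷ l)
    same-end = sym (trans (cong (endOf h) eq) (endOf-suffix h pre z post))
    post⊆ : ∀ {y} → y ∈ˡ post → y ∈ˡ (w ∷ l)
    post⊆ m = subst (_ ∈ˡ_) (sym eq) (∈-++⁺ʳ pre (there m))
    z∈ : z ∈ˡ (w ∷ l)
    z∈ = subst (z ∈ˡ_) (sym eq) (∈-++⁺ʳ pre (here refl))
    jump : z ≡ h ⊎ h ~ z → Shortcut h (w ∷ l)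
    jump (inj₁ refl) with shortcut f z post post-len post-walk
    ... | l' , ip , end , sub = l' , ip , trans end same-end , (λ m → post⊆ (sub m))
    jump (inj₂ hz) with shortcut f z post post-len post-walk
    ... | l' , ip , end , sub =
      z ∷ l' , (hz , All.tabulate far-from-h , ip) , trans end same-end ,
      λ { (here refl) → z∈ ; (there m) → post⊆ (sub m) }
      where
      far-from-h : ∀ {y} → y ∈ˡ l' → ¬ (h ~ y) × ¬ (h ≡ y)
      far-from-h m = let ¬P = All.lookup far (sub m) in (λ hy → ¬P (inj₂ hy)) , (λ h≡y → ¬P (inj₁ (sym h≡y)))

  Consecutive : ∀ {m} → Fin m → Fin m → Set
  Consecutive i j = suc (toℕ i) ≡ toℕ j ⊎ suc (toℕ j) ≡ toℕ i

  induced-adj⇒consecutive : ∀ h l → InducedPath h l → ∀ i j →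
    List.lookup (h ∷ l) i ~ List.lookup (h ∷ l) j → Consecutive i j
  induced-adj⇒consecutive h []      _ zero zero e = ⊥-elim (~-irrefl e)
  induced-adj⇒consecutive h (w ∷ l) _ zero zero e = ⊥-elim (~-irrefl e)
  induced-adj⇒consecutive h (w ∷ l) _ zero (suc zero) e = inj₁ refl
  induced-adj⇒consecutive h (w ∷ l) (_ , far , _) zero (suc (suc j)) e = ⊥-elim (proj₁ (All-at l far j) e)
  induced-adj⇒consecutive h (w ∷ l) _ (suc zero) zero e = inj₂ refl
  induced-adj⇒consecutive h (w ∷ l) (_ , far , _) (suc (suc i)) zero e = ⊥-elim (proj₁ (All-at l far i) (~-sym e))
  induced-adj⇒consecutive h (w ∷ l) (_ , _ , ip) (suc i) (suc j) e =
    Sum.map (cong suc) (cong suc) (induced-adj⇒consecutive w l ip i j e)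

  consecutive⇒induced-adj : ∀ h l → InducedPath h l → ∀ i j → Consecutive i j →
    List.lookup (h ∷ l) i ~ List.lookup (h ∷ l) j
  consecutive⇒induced-adj h []      _ zero zero (inj₁ ())
  consecutive⇒induced-adj h []      _ zero zero (inj₂ ())
  consecutive⇒induced-adj h (w ∷ l) _ zero zero (inj₁ ())
  consecutive⇒induced-adj h (w ∷ l) _ zero zero (inj₂ ())
  consecutive⇒induced-adj h (w ∷ l) (hw , _) zero (suc zero) _ = hw
  consecutive⇒induced-adj h (w ∷ l) _ zero (suc (suc j)) (inj₁ ())
  consecutive⇒induced-adj h (w ∷ l) _ zero (suc (suc j)) (inj₂ ())
  consecutive⇒induced-adj h (w ∷ l) (hw , _) (suc zero) zero _ = ~-sym hw
  consecutive⇒induced-adj h (w ∷ l) _ (suc (suc j)) zero (inj₁ ())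
  consecutive⇒induced-adj h (w ∷ l) _ (suc (suc j)) zero (inj₂ ())
  consecutive⇒induced-adj h (w ∷ l) (_ , _ , ip) (suc i) (suc j) c =
    consecutive⇒induced-adj w l ip i j (Sum.map ℕₚ.suc-injective ℕₚ.suc-injective c)

  induced-injective : ∀ h l → InducedPath h l → ∀ i j →
    List.lookup (h ∷ l) i ≡ List.lookup (h ∷ l) j → i ≡ j
  induced-injective h l _ zero zero _ = refl
  induced-injective h (w ∷ l) (hw , _) zero (suc zero) e = ⊥-elim (~-irrefl (subst (h ~_) (sym e) hw))
  induced-injective h (w ∷ l) (_ , far , _) zero (suc (suc j)) e = ⊥-elim (proj₂ (All-at l far j) e)
  induced-injective h (w ∷ l) (hw , _) (suc zero) zero e = ⊥-elim (~-irrefl (subst (h ~_) e hw))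
  induced-injective h (w ∷ l) (_ , far , _) (suc (suc j)) zero e = ⊥-elim (proj₂ (All-at l far j) (sym e))
  induced-injective h (w ∷ l) (_ , _ , ip) (suc i) (suc j) e = cong suc (induced-injective w l ip i j e)

CycAdj-sym : ∀ {k} {i j : Fin k} → CycAdj k i j → CycAdj k j i
CycAdj-sym (inj₁ a)               = inj₂ (inj₁ a)
CycAdj-sym (inj₂ (inj₁ a))        = inj₁ a
CycAdj-sym (inj₂ (inj₂ (inj₁ a))) = inj₂ (inj₂ (inj₂ a))
CycAdj-sym (inj₂ (inj₂ (inj₂ a))) = inj₂ (inj₂ (inj₁ a))

module Cycles (G : Graph) where
  open Graphs G

  closed-path-cycle : (x h : V) (l : List V) → InducedPath h l →
    (∀ i → ¬ (List.lookup (h ∷ l) i ≡ x)) →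
    (∀ j → x ~ List.lookup (h ∷ l) j → toℕ j ≡ 0 ⊎ suc (toℕ j) ≡ suc (length l)) →
    (∀ j → toℕ j ≡ 0 ⊎ suc (toℕ j) ≡ suc (length l) → x ~ List.lookup (h ∷ l) j) →
    InducedCycle G (suc (suc (length l))) (List.lookup (x ∷ h ∷ l))
  closed-path-cycle x h l ip x-off x-only-ends x-ends = injective , λ i j → mk⇔ (adj⇒cyc i j) (cyc⇒adj i j)
    where
    k : ℕ
    k = suc (suc (length l))

    c : Fin k → V
    c = List.lookup (x ∷ h ∷ l)

    injective : ∀ {i j} → c i ≡ c j → i ≡ j
    injective {zero}  {zero}  _ = refl
    injective {zero}  {suc j} e = ⊥-elim (x-off j (sym e))
    injective {suc i} {zero}  e = ⊥-elim (x-off i e)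
    injective {suc i} {suc j} e = cong suc (induced-injective h l ip i j e)

    x-adj⇒cyc : ∀ j → x ~ List.lookup (h ∷ l) j → CycAdj k zero (suc j)
    x-adj⇒cyc j e with x-only-ends j e
    ... | inj₁ j≡0   = inj₁ (cong suc (sym j≡0))
    ... | inj₂ j≡end = inj₂ (inj₂ (inj₁ (refl , cong suc j≡end)))

    cyc⇒x-adj : ∀ j → CycAdj k zero (suc j) → x ~ List.lookup (h ∷ l) j
    cyc⇒x-adj j (inj₁ a)                     = x-ends j (inj₁ (sym (ℕₚ.suc-injective a)))
    cyc⇒x-adj j (inj₂ (inj₁ ()))
    cyc⇒x-adj j (inj₂ (inj₂ (inj₁ (_ , b)))) = x-ends j (inj₂ (ℕₚ.suc-injective b))
    cyc⇒x-adj j (inj₂ (inj₂ (inj₂ (() , _))))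

    adj⇒cyc : ∀ i j → adj G (c i) (c j) ≡ true → CycAdj k i j
    adj⇒cyc zero    zero    e = ⊥-elim (~-irrefl e)
    adj⇒cyc zero    (suc j) e = x-adj⇒cyc j e
    adj⇒cyc (suc i) zero    e = CycAdj-sym (x-adj⇒cyc i (~-sym e))
    adj⇒cyc (suc i) (suc j) e with induced-adj⇒consecutive h l ip i j e
    ... | inj₁ a = inj₁ (cong suc a)
    ... | inj₂ b = inj₂ (inj₁ (cong suc b))

    cyc⇒adj : ∀ i j → CycAdj k i j → adj G (c i) (c j) ≡ true
    cyc⇒adj zero    zero    (inj₁ ())
    cyc⇒adj zero    zero    (inj₂ (inj₁ ()))
    cyc⇒adj zero    zero    (inj₂ (inj₂ (inj₁ (_ , ()))))
    cyc⇒adj zero    zero    (inj₂ (inj₂ (inj₂ (_ , ()))))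
    cyc⇒adj zero    (suc j) r = cyc⇒x-adj j r
    cyc⇒adj (suc i) zero    r = ~-sym (cyc⇒x-adj i (CycAdj-sym r))
    cyc⇒adj (suc i) (suc j) (inj₁ a)        = consecutive⇒induced-adj h l ip i j (inj₁ (ℕₚ.suc-injective a))
    cyc⇒adj (suc i) (suc j) (inj₂ (inj₁ b)) = consecutive⇒induced-adj h l ip i j (inj₂ (ℕₚ.suc-injective b))
    cyc⇒adj (suc i) (suc j) (inj₂ (inj₂ (inj₁ (() , _))))
    cyc⇒adj (suc i) (suc j) (inj₂ (inj₂ (inj₂ (() , _))))

  snoc-position : (pre : List V) (z : V) (j : Fin (length (pre ++ z ∷ []))) →
    (List.lookup (pre ++ z ∷ []) j ∈ˡ pre × suc (toℕ j) < length (pre ++ z ∷ []))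
    ⊎ (List.lookup (pre ++ z ∷ []) j ≡ z × suc (toℕ j) ≡ length (pre ++ z ∷ []))
  snoc-position []        z zero = inj₂ (refl , refl)
  snoc-position (a ∷ pre) z zero = inj₁ (here refl , s≤s (length-++-≤ʳ (z ∷ []) {pre}))
  snoc-position (a ∷ pre) z (suc j) with snoc-position pre z j
  ... | inj₁ (m , lt) = inj₁ (there m , s≤s lt)
  ... | inj₂ (e , q)  = inj₂ (e , cong suc q)

module ChordalGraphs (G : Graph) (chordal : Chordal G) where
  open Graphs G
  open Cycles G

  -- Otherwise x, s, p₁, …, z, where z
  -- is the first neighbour of x after p₁, is an induced cycle of length ≥ 4.
  chord : (x s p₁ : V) (rest : List V) → InducedPath s (p₁ ∷ rest) → x ~ s → x ~ endOf s (p₁ ∷ rest) →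
    ¬ (x ≡ s) → All (λ z → ¬ (x ≡ z)) (p₁ ∷ rest) → x ~ p₁
  chord x s p₁ rest ip xs xe x≢s x-off with x ~? p₁
  ... | yes xp₁ = xp₁
  ... | no ¬xp₁ with split-first (x ~?_) (p₁ ∷ rest) (Any.map (λ e → subst (x ~_) e xe) (endOf-∈ s p₁ rest))
  ...   | []      , z , post , refl , xz , _      = ⊥-elim (¬xp₁ xz)
  ...   | a ∷ pre , z , post , eq   , xz , before =
    ⊥-elim (chordal _ (s≤s (s≤s (s≤s (length-++-≤ʳ (z ∷ []) {pre})))) _
      (closed-path-cycle x s M ip-M x-off-M x-adj⇒end end⇒x-adj))
    where
    M : List V
    M = (a ∷ pre) ++ z ∷ []
    ip-M : InducedPath s M
    ip-M = InducedPath-prefix s (a ∷ pre) z post (subst (InducedPath s) eq ip)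
    x-off-M : ∀ i → ¬ (List.lookup (s ∷ M) i ≡ x)
    x-off-M i e = All-at (s ∷ M) (x≢s ∷ All-prefix (a ∷ pre) (subst (All _) eq x-off)) i (sym e)
    x-adj⇒end : ∀ j → x ~ List.lookup (s ∷ M) j → toℕ j ≡ 0 ⊎ suc (toℕ j) ≡ suc (length M)
    x-adj⇒end zero    _ = inj₁ refl
    x-adj⇒end (suc j) e with snoc-position (a ∷ pre) z j
    ... | inj₁ (m , _) = ⊥-elim (All.lookup before m e)
    ... | inj₂ (_ , q) = inj₂ (cong suc q)
    end⇒x-adj : ∀ j → toℕ j ≡ 0 ⊎ suc (toℕ j) ≡ suc (length M) → x ~ List.lookup (s ∷ M) j
    end⇒x-adj zero    _         = xs
    end⇒x-adj (suc j) (inj₁ ())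
    end⇒x-adj (suc j) (inj₂ e) with snoc-position (a ∷ pre) z j
    ... | inj₁ (_ , lt) = ⊥-elim (ℕₚ.<-irrefl (ℕₚ.suc-injective e) lt)
    ... | inj₂ (q , _)  = subst (x ~_) (sym q) xz

module Separation (G : Graph) where
  open Graphs G

  Path : Subset (n G) → V → V → Set
  Path X = PathAvoiding G X

  path-start∉ : ∀ {X u v} → Path X u v → u ∉ X
  path-start∉ (here u∉)     = u∉
  path-start∉ (step u∉ _ _) = u∉

  path-end∉ : ∀ {X u v} → Path X u v → v ∉ X
  path-end∉ (here v∉)    = v∉
  path-end∉ (step _ _ p) = path-end∉ p

  path-snoc : ∀ {X u v w} → Path X u v → v ~ w → w ∉ X → Path X u w
  path-snoc (here u∉)     e w∉ = step u∉ e (here w∉)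
  path-snoc (step u∉ e p) f w∉ = step u∉ e (path-snoc p f w∉)

  path-reverse : ∀ {X u v} → Path X u v → Path X v u
  path-reverse (here u∉)     = here u∉
  path-reverse (step u∉ e p) = path-snoc (path-reverse p) (~-sym e) u∉

  path-weaken : ∀ {X Y u v} → X ⊆ Y → Path Y u v → Path X u v
  path-weaken sub (here u∉)     = here (λ m → u∉ (sub m))
  path-weaken sub (step u∉ e p) = step (λ m → u∉ (sub m)) e (path-weaken sub p)

  path-tail : ∀ {X u v} → Path X u v → List V
  path-tail (here _)              = []
  path-tail (step {w = w} _ _ p) = w ∷ path-tail p

  path-walk : ∀ {X u v} (p : Path X u v) → Walk u (path-tail p)
  path-walk (here _)     = tt
  path-walk (step _ e p) = e , path-walk p

  path-endOf : ∀ {X u v} (p : Path X u v) → endOf u (path-tail p) ≡ v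
  path-endOf (here _)     = refl
  path-endOf (step _ _ p) = path-endOf p

  path-tail-reaches : ∀ {X u v} (p : Path X u v) → All (λ z → Path X z v) (path-tail p)
  path-tail-reaches (here _)     = []
  path-tail-reaches (step _ _ p) = p ∷ path-tail-reaches p

  CliqueAttached : Subset (n G) → Set
  CliqueAttached A = ∀ {a b y₁ y₂} → a ∈ A → b ∈ A → ¬ (a ≡ b) → a ~ y₁ → b ~ y₂ → Path A y₁ y₂ → a ~ b

  Dominant : Subset (n G) → V → Set
  Dominant A h = ∀ {a y} → a ∈ A → Path A h y → a ~ y → a ~ h

  attached-extend : ∀ {A h} → CliqueAttached A → h ∉ A → Dominant A h → CliqueAttached (A ∪ ⁅ h ⁆)
  attached-extend {A} {h} attached h∉ dom {a} {b} a∈ b∈ a≢b ay₁ by₂ p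
    with ∈∪⁅⁆⁻ {A = A} a∈ | ∈∪⁅⁆⁻ {A = A} b∈
  ... | inj₁ a∈A | inj₁ b∈A = attached a∈A b∈A a≢b ay₁ by₂ (path-weaken ∈∪⁅⁆ˡ p)
  ... | inj₂ refl | inj₁ b∈A = ~-sym (dom b∈A (step h∉ ay₁ (path-weaken ∈∪⁅⁆ˡ p)) by₂)
  ... | inj₁ a∈A | inj₂ refl = dom a∈A (step h∉ by₂ (path-reverse (path-weaken ∈∪⁅⁆ˡ p))) ay₁
  ... | inj₂ refl | inj₂ refl = ⊥-elim (a≢b refl)

  -- If h ∉ A is dominant, the neighbours of h in A separate h from A: every
  -- path from h towards A leaves the component of h at a vertex of A adjacent
  -- to that component, hence adjacent to h.  (r tracks the walk so far in G − A.)
  dominant-separates : ∀ {A h u v} → Dominant A h → Path (nbrsIn h A) u v → Path A h u → v ∉ A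
  dominant-separates dom (here _) r v∈ = path-end∉ r v∈
  dominant-separates {A} {h} dom (step {w = w} _ e p) r v∈ with w ∈? A
  ... | yes w∈ = path-start∉ p (nbrsIn⁺ (~-sym (dom w∈ r (~-sym e))) w∈)
  ... | no  w∉ = dominant-separates dom p (path-snoc r e w∉) v∈

module DominantVertex (G : Graph) (chordal : Chordal G) where
  open Graphs G
  open Separation G
  open ChordalGraphs G chordal

  -- If a ∈ A sees the component of
  -- h but not h, shortcut the walk a, y, …, h to an induced path a, p₁, …, h.
  -- By the chord lemma every neighbour of h in A also sees p₁, and so does a:
  -- p₁ would have more neighbours in A than h.
  maximal-dominant : ∀ A → CliqueAttached A → ∀ h → h ∉ A →
    (∀ h' → h' ∉ A → ∣ nbrsIn h' A ∣ ≤ ∣ nbrsIn h A ∣) → Dominant A h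
  maximal-dominant A attached h h∉ max {a} {y} a∈ p ay with a ~? h
  ... | yes ah = ah
  ... | no ¬ah with shortcut _ a (y ∷ path-tail (path-reverse p)) ℕₚ.≤-refl (ay , path-walk (path-reverse p))
  ... | l , ip , end , l⊆ = contradiction l ip end (All.tabulate (λ m → All.lookup reaches (l⊆ m)))
    where
    q = path-reverse p
    reaches : All (λ z → Path A z h) (y ∷ path-tail q)
    reaches = q ∷ path-tail-reaches q
    contradiction : (l : List V) → InducedPath a l → endOf a l ≡ endOf a (y ∷ path-tail q) →
      All (λ z → Path A z h) l → a ~ h
    contradiction [] _ end _ = ⊥-elim (h∉ (subst (_∈ A) (trans end (path-endOf q)) a∈))
    contradiction (p₁ ∷ rest) ip end reach =
      ⊥-elim (ℕₚ.<⇒≱ more (max p₁ (path-start∉ (All.head reach))))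
      where
      ends-at-h : endOf a (p₁ ∷ rest) ≡ h
      ends-at-h = trans end (path-endOf q)
      -- a neighbour s of h in A is adjacent to a and off the path, so sees p₁
      grows : nbrsIn h A ⊆ nbrsIn p₁ A
      grows {s} m with nbrsIn⁻ {h} {s} {A} m
      ... | hs , s∈ = nbrsIn⁺ (~-sym (chord s a p₁ rest ip sa (subst (s ~_) (sym ends-at-h) (~-sym hs)) s≢a s-off)) s∈
        where
        s≢a : ¬ (s ≡ a)
        s≢a refl = ¬ah (~-sym hs)
        sa : s ~ a
        sa = attached s∈ a∈ s≢a (~-sym hs) ay p
        s-off : All (λ z → ¬ (s ≡ z)) (p₁ ∷ rest)
        s-off = All.map (λ r e → path-start∉ r (subst (_∈ A) e s∈)) reach
      more : ∣ nbrsIn h A ∣ < ∣ nbrsIn p₁ A ∣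
      more = Subsetₚ.p⊂q⇒∣p∣<∣q∣ (grows , a , nbrsIn⁺ (~-sym (proj₁ ip)) a∈ ,
                                   λ m → ¬ah (~-sym (proj₁ (nbrsIn⁻ {h} {a} {A} m))))

module Extension (G : Graph) (chordal : Chordal G) (t : ℕ) (conn : Connectedness t G) where
  open Graphs G
  open Separation G
  open DominantVertex G chordal

  -- In the second case N(h) ∩ A has < t vertices, so G − N(h) ∩ A is
  -- connected, and dominant-separates forces every a ∈ A into N(h).
  next-vertex : ∀ A → CliqueAttached A → (x : V) → x ∉ A →
    Σ[ h ∈ V ] (h ∉ A × Dominant A h × (t ≤ ∣ nbrsIn h A ∣ ⊎ (∀ {a} → a ∈ A → h ~ a)))
  next-vertex A attached x x∉ with argmax (n G) (λ h → ∣ nbrsIn h A ∣) (_∉ A) (λ h → ¬? (h ∈? A))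
  ... | inj₁ none = ⊥-elim (none x x∉)
  ... | inj₂ (h , h∉ , max) = h , h∉ , dom , few-or-many
    where
    dom : Dominant A h
    dom = maximal-dominant A attached h h∉ max
    few-or-many : t ≤ ∣ nbrsIn h A ∣ ⊎ (∀ {a} → a ∈ A → h ~ a)
    few-or-many with t ℕₚ.≤? ∣ nbrsIn h A ∣
    ... | yes many = inj₁ many
    ... | no  few  = inj₂ sees-all
      where
      sees-all : ∀ {a} → a ∈ A → h ~ a
      sees-all {a} a∈ with a ∈? nbrsIn h A
      ... | yes m = proj₁ (nbrsIn⁻ {h} {a} {A} m)
      ... | no  m = ⊥-elim (dominant-separates dom
                      (proj₂ conn (nbrsIn h A) (ℕₚ.≰⇒> few) h a (λ hm → h∉ (proj₂ (nbrsIn⁻ {h} {h} {A} hm))) m)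
                      (here h∉) a∈)

decided : ∀ {P : Set} (d : Dec P) → ⌊ d ⌋ ≡ true → P
decided (yes p) _ = p
decided (no _)  ()

decide-true : ∀ {P : Set} (d : Dec P) → P → ⌊ d ⌋ ≡ true
decide-true (yes _) _ = refl
decide-true (no ¬p) p = ⊥-elim (¬p p)

module Activation (G : Graph) (θ : Threshold G) where
  open Graphs G

  round : Subset (n G) → Subset (n G)
  round = activationStep G θ

  lookup-round : ∀ A u → lookup (round A) u ≡ (lookup A u ∨ ⌊ θ u ℤ.≤? + ∣ nbrsIn u A ∣ ⌋)
  lookup-round A u = Vecₚ.lookup∘tabulate _ u

  round-inflationary : ∀ {A} → A ⊆ round A
  round-inflationary {A} {x} m =
    Vecₚ.lookup⇒[]= x (round A) (trans (lookup-round A x) (cong (_∨ ⌊ θ x ℤ.≤? + ∣ nbrsIn x A ∣ ⌋) (Vecₚ.[]=⇒lookup m)))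

  round-activates : ∀ {A h} → θ h ℤ.≤ + ∣ nbrsIn h A ∣ → h ∈ round A
  round-activates {A} {h} enough = Vecₚ.lookup⇒[]= h (round A) (begin
    lookup (round A) h                                    ≡⟨ lookup-round A h ⟩
    lookup A h ∨ ⌊ θ h ℤ.≤? + ∣ nbrsIn h A ∣ ⌋          ≡⟨ cong (lookup A h ∨_) (decide-true (θ h ℤ.≤? _) enough) ⟩
    lookup A h ∨ true                                    ≡⟨ ∨-zeroʳ _ ⟩
    true                                                 ∎)
    where open ≡-Reasoning

  ∈round⁻ : ∀ {A x} → x ∈ round A → x ∈ A ⊎ θ x ℤ.≤ + ∣ nbrsIn x A ∣
  ∈round⁻ {A} {x} m with lookup A x in eq | trans (sym (lookup-round A x)) (Vecₚ.[]=⇒lookup m)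
  ... | true  | _     = inj₁ (Vecₚ.lookup⇒[]= x A eq)
  ... | false | fires = inj₂ (decided (θ x ℤ.≤? _) fires)

  round-monotone : ∀ {A B} → A ⊆ B → round A ⊆ round B
  round-monotone {A} {B} A⊆B {x} m with ∈round⁻ m
  ... | inj₁ x∈A    = round-inflationary (A⊆B x∈A)
  ... | inj₂ enough =
    round-activates (ℤₚ.≤-trans enough (ℤ.+≤+ (Subsetₚ.p⊆q⇒∣p∣≤∣q∣ (nbrsIn-monotone A⊆B))))

  iter-monotone : ∀ {S k m} → k ≤ m → iter k round S ⊆ iter m round S
  iter-monotone {k = zero}  {zero}  z≤n      x∈ = x∈
  iter-monotone {k = zero}  {suc m} z≤n      x∈ = round-inflationary (iter-monotone {k = zero} {m} z≤n x∈)
  iter-monotone {k = suc k} {suc m} (s≤s le) x∈ = round-monotone (iter-monotone le) x∈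

  -- Growing A one
  -- vertex at a time keeps this invariant, and A = V(G) then means that S
  -- activates everything within the |V(G)| rounds of the closure.
  Reached : Subset (n G) → Subset (n G) → Set
  Reached S A = A ⊆ iter ∣ A ∣ round S

  reached : ∀ {S A k} → A ⊆ iter k round S → k ≤ ∣ A ∣ → Reached S A
  reached A⊆ k≤ x∈ = iter-monotone k≤ (A⊆ x∈)

  reached-extend : ∀ {S A h} → Reached S A → h ∉ A → θ h ℤ.≤ + ∣ nbrsIn h A ∣ → Reached S (A ∪ ⁅ h ⁆)
  reached-extend {S} {A} {h} r h∉ enough {x} x∈ =
    subst (λ k → x ∈ iter k round S) (sym (∣∪⁅⁆∣ A h h∉)) (active (∈∪⁅⁆⁻ x∈))
    where
    active : x ∈ A ⊎ x ≡ h → x ∈ round (iter ∣ A ∣ round S)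
    active (inj₁ x∈A) = round-inflationary (r x∈A)
    active (inj₂ refl) = round-monotone r (round-activates enough)

  reached-all : ∀ {S} → Reached S ⊤ → Seeds G θ S
  reached-all {S} r =
    Subsetₚ.⊆-antisym Subsetₚ.⊆⊤ (λ x∈ → subst (λ k → _ ∈ iter k round S) (Subsetₚ.∣⊤∣≡n (n G)) (r x∈))

module ConstantThreshold (G : Graph) (t : ℕ) where
  open Graphs G
  open Activation G (const-θ G t)

  small-sets-inert : ∀ S → ∣ S ∣ < t → round S ≡ S
  small-sets-inert S small = trans (Vecₚ.tabulate-cong unchanged) (Vecₚ.tabulate∘lookup S)
    where
    unchanged : ∀ u → (lookup S u ∨ ⌊ + t ℤ.≤? + ∣ nbrsIn u S ∣ ⌋) ≡ lookup S u
    unchanged u with + t ℤ.≤? + ∣ nbrsIn u S ∣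
    ... | yes enough = ⊥-elim (ℕₚ.<⇒≱ small
                         (ℕₚ.≤-trans (ℤₚ.drop‿+≤+ enough) (Subsetₚ.∣p∩q∣≤∣q∣ (N G u) S)))
    ... | no  _      = ∨-identityʳ _

  seeds-large : t ≤ n G → ∀ S → Seeds G (const-θ G t) S → t ≤ ∣ S ∣
  seeds-large t≤n S seeds with t ℕₚ.≤? ∣ S ∣
  ... | yes large = large
  ... | no  small = ⊥-elim (small (ℕₚ.≤-trans t≤n (ℕₚ.≤-reflexive everything)))
    where
    stuck : ∀ k → iter k round S ≡ S
    stuck zero    = refl
    stuck (suc k) = trans (cong round (stuck k)) (small-sets-inert S (ℕₚ.≰⇒> small))
    everything : n G ≡ ∣ S ∣
    everything = begin
      n G         ≡⟨ sym (Subsetₚ.∣⊤∣≡n (n G)) ⟩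
      ∣ ⊤ {n G} ∣ ≡⟨ cong ∣_∣ (sym (trans (sym (stuck (n G))) seeds)) ⟩
      ∣ S ∣       ∎
      where open ≡-Reasoning

module Constructions (G : Graph) (chordal : Chordal G) (t : ℕ) (conn : Connectedness t G) where
  open Graphs G
  open Separation G
  open Extension G chordal t conn

  activate-rest : (θ : Threshold G) → (∀ x → θ x ℤ.≤ + t) → ∀ d {S} A → d + ∣ A ∣ ≡ n G →
    t ≤ ∣ A ∣ → CliqueAttached A → Activation.Reached G θ S A → Seeds G θ S
  activate-rest θ θ≤t zero A all-of-G _ _ r =
    reached-all (subst (Reached _) (Subsetₚ.∣p∣≡n⇒p≡⊤ all-of-G) r)
    where open Activation G θ
  activate-rest θ θ≤t (suc d) A size t≤A attached r
    with outside-element A (subst (∣ A ∣ <_) size (ℕₚ.m<n+m ∣ A ∣ (s≤s z≤n)))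
  ... | x , x∉ with next-vertex A attached x x∉
  ... | h , h∉ , dom , cases =
    activate-rest θ θ≤t d (A ∪ ⁅ h ⁆) size′ t≤A′ (attached-extend attached h∉ dom)
      (reached-extend r h∉ (ℤₚ.≤-trans (θ≤t h) (ℤ.+≤+ (enough cases))))
    where
    open Activation G θ
    enough : t ≤ ∣ nbrsIn h A ∣ ⊎ (∀ {a} → a ∈ A → h ~ a) → t ≤ ∣ nbrsIn h A ∣
    enough (inj₁ many)    = many
    enough (inj₂ sees-all) = ℕₚ.≤-trans t≤A (nbrsIn-all sees-all)
    size′ : d + ∣ A ∪ ⁅ h ⁆ ∣ ≡ n G
    size′ = trans (cong (λ k → d + k) (∣∪⁅⁆∣ A h h∉)) (trans (ℕₚ.+-suc d ∣ A ∣) size)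
    t≤A′ : t ≤ ∣ A ∪ ⁅ h ⁆ ∣
    t≤A′ = ℕₚ.≤-trans t≤A (ℕₚ.≤-trans (ℕₚ.n≤1+n _) (ℕₚ.≤-reflexive (sym (∣∪⁅⁆∣ A h h∉))))

  record Nucleus (v : V) (j : ℕ) : Set where
    field
      others   : Subset (n G)
      v∉       : v ∉ others
      size     : ∣ others ∪ ⁅ v ⁆ ∣ ≡ suc j
      attached : CliqueAttached (others ∪ ⁅ v ⁆)
      v-sees   : ∀ {a} → a ∈ others → v ~ a

  nucleus-single : (v : V) → Nucleus v 0
  nucleus-single v = record
    { others = Sb.⊥ ; v∉ = Subsetₚ.∉⊥
    ; size = trans (cong ∣_∣ (Subsetₚ.∪-identityˡ ⁅ v ⁆)) (Subsetₚ.∣⁅x⁆∣≡1 v)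
    ; attached = λ a∈ b∈ a≢b _ _ _ → ⊥-elim (a≢b (trans (only-v a∈) (sym (only-v b∈))))
    ; v-sees = λ m → ⊥-elim (Subsetₚ.∉⊥ m) }
    where
    only-v : ∀ {a} → a ∈ Sb.⊥ ∪ ⁅ v ⁆ → a ≡ v
    only-v m with ∈∪⁅⁆⁻ {A = Sb.⊥} m
    ... | inj₁ a∈⊥ = ⊥-elim (Subsetₚ.∉⊥ a∈⊥)
    ... | inj₂ a≡v = a≡v

  -- A nucleus with fewer than t vertices grows: having < t neighbours in it,
  -- the vertex given by the extension step is adjacent to all of it.
  nucleus-grow : ∀ {v j} → Nucleus v j → suc (suc j) ≤ t → Nucleus v (suc j)
  nucleus-grow {v} {j} K j+2≤t
    with outside-element (Nucleus.others K ∪ ⁅ v ⁆)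
           (ℕₚ.<-trans (subst (_< t) (sym (Nucleus.size K)) j+2≤t) (proj₁ conn))
  ... | x , x∉ with next-vertex _ (Nucleus.attached K) x x∉
  ... | h , h∉ , dom , inj₁ many =
    ⊥-elim (ℕₚ.<⇒≱ j+2≤t (ℕₚ.≤-trans many (ℕₚ.≤-trans (Subsetₚ.∣p∩q∣≤∣q∣ (N G h) _)
                                                      (ℕₚ.≤-reflexive (Nucleus.size K)))))
  ... | h , h∉ , dom , inj₂ sees-all = record
    { others = S ∪ ⁅ h ⁆ ; v∉ = v∉′
    ; size = trans (cong ∣_∣ reorder) (trans (∣∪⁅⁆∣ (S ∪ ⁅ v ⁆) h h∉) (cong suc (Nucleus.size K)))
    ; attached = subst CliqueAttached (sym reorder) (attached-extend (Nucleus.attached K) h∉ dom)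
    ; v-sees = v-sees′ }
    where
    S = Nucleus.others K
    reorder : (S ∪ ⁅ h ⁆) ∪ ⁅ v ⁆ ≡ (S ∪ ⁅ v ⁆) ∪ ⁅ h ⁆
    reorder = begin
      (S ∪ ⁅ h ⁆) ∪ ⁅ v ⁆   ≡⟨ Subsetₚ.∪-assoc S ⁅ h ⁆ ⁅ v ⁆ ⟩
      S ∪ (⁅ h ⁆ ∪ ⁅ v ⁆)   ≡⟨ cong (S ∪_) (Subsetₚ.∪-comm ⁅ h ⁆ ⁅ v ⁆) ⟩
      S ∪ (⁅ v ⁆ ∪ ⁅ h ⁆)   ≡⟨ sym (Subsetₚ.∪-assoc S ⁅ v ⁆ ⁅ h ⁆) ⟩
      (S ∪ ⁅ v ⁆) ∪ ⁅ h ⁆   ∎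
      where open ≡-Reasoning
    v∉′ : v ∉ S ∪ ⁅ h ⁆
    v∉′ m with ∈∪⁅⁆⁻ {A = S} m
    ... | inj₁ v∈S = Nucleus.v∉ K v∈S
    ... | inj₂ v≡h = h∉ (subst (_∈ S ∪ ⁅ v ⁆) v≡h ∈∪⁅⁆ʳ)
    v-sees′ : ∀ {a} → a ∈ S ∪ ⁅ h ⁆ → v ~ a
    v-sees′ m with ∈∪⁅⁆⁻ {A = S} m
    ... | inj₁ a∈S  = Nucleus.v-sees K a∈S
    ... | inj₂ refl = ~-sym (sees-all ∈∪⁅⁆ʳ)

  nucleus : (v : V) (j : ℕ) → suc j ≤ t → Nucleus v j
  nucleus v zero    _      = nucleus-single v
  nucleus v (suc j) j+2≤t = nucleus-grow (nucleus v j (ℕₚ.≤-trans (ℕₚ.n≤1+n _) j+2≤t)) j+2≤t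

-- Both parts of the theorem, stated for threshold bound t + 1 ≥ 1.
module MinSeed (G : Graph) (chordal : Chordal G) (t : ℕ) (conn : Connectedness (suc t) G) where
  open Graphs G
  open Separation G
  open Constructions G chordal (suc t) conn

  t<n : suc t < n G
  t<n = proj₁ conn

  remaining : ∀ (A : Subset (n G)) → ∣ A ∣ ≡ suc t → (n G ∸ suc t) + ∣ A ∣ ≡ n G
  remaining A size = trans (cong (λ k → (n G ∸ suc t) + k) size) (ℕₚ.m∸n+n≡m (ℕₚ.<⇒≤ t<n))

  min-seed-constant : MinSeedIs G (const-θ G (suc t)) (suc t)
  min-seed-constant = (K , seeds , size) , ConstantThreshold.seeds-large G (suc t) (ℕₚ.<⇒≤ t<n)
    where
    v₀ : V
    v₀ = Data.Fin.fromℕ< (ℕₚ.<-trans (s≤s z≤n) t<n)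
    open Nucleus (nucleus v₀ t ℕₚ.≤-refl)
    K : Subset (n G)
    K = others ∪ ⁅ v₀ ⁆
    seeds : Seeds G (const-θ G (suc t)) K
    seeds = activate-rest (const-θ G (suc t)) (λ _ → ℤₚ.≤-refl) (n G ∸ suc t) K (remaining K size)
              (ℕₚ.≤-reflexive (sym size)) attached (Activation.reached G _ (λ x∈ → x∈) z≤n)

  -- (b) If θ ≤ t + 1 and θ(w) ≤ t, the t vertices of a nucleus around w other
  -- than w seed G: after one round w is active as well.
  min-seed-below : (θ : Threshold G) → (∀ x → θ x ℤ.≤ + suc t) → Σ V (λ w → θ w ℤ.< + suc t) →
    MinSeedBelow G θ (suc t)
  min-seed-below θ θ≤ (w , θw<) = others , seeds , ℕₚ.≤-reflexive (cong suc size-others)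
    where
    open Nucleus (nucleus w t ℕₚ.≤-refl)
    open Activation G θ
    size-others : ∣ others ∣ ≡ t
    size-others = ℕₚ.suc-injective (trans (sym (∣∪⁅⁆∣ others w v∉)) size)
    w-fires : θ w ℤ.≤ + ∣ nbrsIn w others ∣
    w-fires = ℤₚ.≤-trans (i<j⇒i≤pred[j] θw<) (ℤ.+≤+ (subst (_≤ ∣ nbrsIn w others ∣) size-others (nbrsIn-all v-sees)))
    after-one-round : others ∪ ⁅ w ⁆ ⊆ iter 1 round others
    after-one-round x∈ with ∈∪⁅⁆⁻ {A = others} x∈
    ... | inj₁ x∈S  = round-inflationary x∈S
    ... | inj₂ refl = round-activates w-fires
    seeds : Seeds G θ others
    seeds = activate-rest θ θ≤ (n G ∸ suc t) (others ∪ ⁅ w ⁆) (remaining (others ∪ ⁅ w ⁆) size) (ℕₚ.≤-reflexive (sym size))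
              attached (reached after-one-round (subst (1 ≤_) (sym size) (s≤s z≤n)))

-- Theorem 9.
theorem9 : (t : ℕ) → 2 ≤ t → (G : Graph) → Connectedness t G → Chordal G →
    MinSeedIs G (const-θ G t) t
    × ((θ : Threshold G) → (∀ x → θ x ℤ.≤ + t) → Σ (Fin (n G)) (λ v → θ v ℤ.< + t) →
       MinSeedBelow G θ t)
theorem9 zero    ()
theorem9 (suc t) _  G conn chordal = min-seed-constant , min-seed-below
  where open MinSeed G chordal t conn
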